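{- Let $\Sigma$ be an effect signature, $Q$ a complete lattice and $\mathcal{Q}$ a decomposable set of leaf-monotone modalities on $Q$. Let $R\subseteq X\times Y$, $a\in TTX$ and $b\in TTY$. If $a\,\mathcal{Q}(\mathcal{Q}(R))\,b$, then $\mu a\,\mathcal{Q}(R)\,\mu b$.
   Context: Effect signature: a set $\Sigma$ of operation symbols, each with an arity of one of the forms $\alpha^n\to\alpha$ ($n\in\mathbb{N}$), $\mathbb{N}\times\alpha^n\to\alpha$, or $\alpha^{\mathbb{N}}\to\alpha$. For a set $X$, $TX$ is the set of effect trees over $X$: labelled, possibly infinite-depth trees whose nodes are either a leaf labelled $\bot$, a leaf labelled by some $x\in X$, a node labelled $\sigma$ with children $t_1,\dots,t_n$ (for $\sigma:\alpha^n\to\alpha$), a node labelled $\sigma$ with children $t_0,t_1,\dots$ (for $\sigma:\alpha^{\mathbb{N}}\to\alpha$), or a node labelled $\sigma_m$ ($m\in\mathbb{N}$) with children $t_1,\dots,t_n$ (for $\sigma:\mathbb{N}\times\alpha^n\to\alpha$). For $h:X\to Y$, $h^*:TX\to TY$ replaces every non-$\bot$ leaf $x$ by $h(x)$. $\mu:TTX\to TX$ flattens a tree of trees by grafting each leaf tree in place of its leaf. $Q$ is a complete lattice with order $\le$. A modality $q$ is a function $[\![q]\!]:TQ\to Q$; for $h:X\to Q$ and $t\in TX$ write $(t\in q(h)) := [\![q]\!](h^*(t))$. Leaf order on $TQ$: $t\,T(\le)\,r$ iff $r$ is obtained from $t$ by replacing each leaf labelled $a\in Q$ by a leaf labelled some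 $b\ge a$ ($\bot$ leaves and internal nodes unchanged). $q$ is leaf-monotone if $t\,T(\le)\,r$ implies $[\![q]\!](t)\le[\![q]\!](r)$. For $R\subseteq X\times Y$ and $h:X\to Q$, $(R{\upharpoonright}h)(y):=\sup\{h(x)\mid x\in X,\ xRy\}$. The relator: for $R\subseteq X\times Y$, $t\,\mathcal{Q}(R)\,r$ (for $t\in TX$, $r\in TY$) iff for all $q\in\mathcal{Q}$ and all $h:X\to Q$, $(t\in q(h))\le(r\in q(R{\upharpoonright}h))$. Preorder $\preceq$ on $TQ$: $t\preceq t'$ iff for all $q\in\mathcal{Q}$ and all monotone $h:Q\to Q$, $(t\in q(h))\le(t'\in q(h))$. $H:TQ\to Q$ is in $\mathrm{QBS}$ if $t\preceq t'$ implies $H(t)\le H(t')$. Preorder $\trianglelefteq$ on $TTQ$: $r\trianglelefteq r'$ iff for all $q\in\mathcal{Q}$ and all $H\in\mathrm{QBS}$, $(r\in q(H))\le(r'\in q(H))$. $\mathcal{Q}$ is decomposable if for all $r,r'\in TTQ$, $r\trianglelefteq r'$ implies $\mu r\preceq\mu r'$. -}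

module Defs where

open import Data.Nat using (ℕ; _<_)
open import Data.List using (List; []; _∷_)
open import Data.Unit using (⊤)
open import Data.Empty using (⊥)
open import Data.Product using (Σ; _×_; proj₁)
open import Relation.Binary.PropositionalEquality using (_≡_)
open import Relation.Binary.Structures using (IsPartialOrder)

record CompleteLattice : Set₁ where
  field
    Carrier        : Set
    _≤_            : Carrier → Carrier → Set
    isPartialOrder : IsPartialOrder _≡_ _≤_
    ⋁              : {I : Set} → (I → Carrier) → Carrier
    ⋁-upper        : {I : Set} (f : I → Carrier) (i : I) → f i ≤ ⋁ f
    ⋁-least        : {I : Set} (f : I → Carrier) (u : Carrier) →
                     ((i : I) → f i ≤ u) → ⋁ f ≤ u

-- alg n : α^n → α ;  par n : ℕ × α^n → α ;  inf : α^ℕ → α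
data Arity : Set where
  alg : ℕ → Arity
  par : ℕ → Arity
  inf : Arity

record Signature : Set₁ where
  field
    Op    : Set
    arity : Op → Arity

-- the extra parameter carried by a node (the m in σ_m)
Param : Arity → Set
Param (alg n) = ⊤
Param (par n) = ℕ
Param inf     = ⊤

Child : Arity → ℕ → Set
Child (alg n) i = i < n
Child (par n) i = i < n
Child inf     i = ⊤

module _ (S : Signature) where
  open Signature S

  data Label (X : Set) : Set where
    botL  : Label X
    leafL : X → Label X
    nodeL : (σ : Op) → Param (arity σ) → Label X

  -- Effect trees (possibly infinite depth), represented as the labelling
  -- function on finite paths (lists of child indices) from the root.
  -- Only values at valid paths (see Valid) are meaningful.
  Tree : Set → Set
  Tree X = List ℕ → Label X

  sub : {X : Set} → Tree X → ℕ → Tree X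
  sub t i p = t (i ∷ p)

  ValidStep : {X : Set} → Label X → ℕ → Set
  ValidStep botL        i = ⊥
  ValidStep (leafL x)   i = ⊥
  ValidStep (nodeL σ m) i = Child (arity σ) i

  Valid : {X : Set} → Tree X → List ℕ → Set
  Valid t []      = ⊤
  Valid t (i ∷ p) = ValidStep (t []) i × Valid (sub t i) p

  mapLabel : {X Y : Set} → (X → Y) → Label X → Label Y
  mapLabel h botL        = botL
  mapLabel h (leafL x)   = leafL (h x)
  mapLabel h (nodeL σ m) = nodeL σ m

  tmap : {X Y : Set} → (X → Y) → Tree X → Tree Y
  tmap h t p = mapLabel h (t p)

  μ : {X : Set} → Tree (Tree X) → Tree X
  μ t p with t []
  μ t p       | botL      = botL
  μ t p       | leafL s   = s p
  μ t []      | nodeL σ m = nodeL σ m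
  μ t (i ∷ p) | nodeL σ m = μ (sub t i) p

  data LabelRel {A B : Set} (_~_ : A → B → Set) : Label A → Label B → Set where
    botR  : LabelRel _~_ botL botL
    leafR : {a : A} {b : B} → a ~ b → LabelRel _~_ (leafL a) (leafL b)
    nodeR : (σ : Op) (m : Param (arity σ)) → LabelRel _~_ (nodeL σ m) (nodeL σ m)

  module _ (L : CompleteLattice) where
    open CompleteLattice L renaming (Carrier to Q)

    Modality : Set
    Modality = Tree Q → Q

    _∈ₘ_⟨_⟩ : {X : Set} → Tree X → Modality → (X → Q) → Q
    t ∈ₘ q ⟨ h ⟩ = q (tmap h t)

    _T≤_ : Tree Q → Tree Q → Set
    t T≤ r = (p : List ℕ) → Valid t p → LabelRel _≤_ (t p) (r p)

    LeafMonotone : Modality → Set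
    LeafMonotone q = (t r : Tree Q) → t T≤ r → q t ≤ q r

    _↾_ : {X Y : Set} → (X → Y → Set) → (X → Q) → Y → Q
    (R ↾ h) y = ⋁ {Σ _ (λ x → R x y)} (λ xr → h (proj₁ xr))

    module _ (𝒬 : Modality → Set) where

      Rel𝒬 : {X Y : Set} → (X → Y → Set) → Tree X → Tree Y → Set
      Rel𝒬 R t r = (q : Modality) → 𝒬 q → (h : _ → Q) →
                   (t ∈ₘ q ⟨ h ⟩) ≤ (r ∈ₘ q ⟨ R ↾ h ⟩)

      MonotoneQ : (Q → Q) → Set
      MonotoneQ h = {a b : Q} → a ≤ b → h a ≤ h b

      _⪯_ : Tree Q → Tree Q → Set
      t ⪯ t' = (q : Modality) → 𝒬 q → (h : Q → Q) → MonotoneQ h →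
               (t ∈ₘ q ⟨ h ⟩) ≤ (t' ∈ₘ q ⟨ h ⟩)

      QBS : (Tree Q → Q) → Set
      QBS H = (t t' : Tree Q) → t ⪯ t' → H t ≤ H t'

      _⊴_ : Tree (Tree Q) → Tree (Tree Q) → Set
      r ⊴ r' = (q : Modality) → 𝒬 q → (H : Tree Q → Q) → QBS H →
               (r ∈ₘ q ⟨ H ⟩) ≤ (r' ∈ₘ q ⟨ H ⟩)

      Decomposable : Set
      Decomposable = (r r' : Tree (Tree Q)) → r ⊴ r' → μ r ⪯ μ r'

-- Push the hypothesis through the decomposability of 𝒬. For h : X → Q put
-- h' := R ↾ h. A pair t 𝒬(R) s gives h^*(t) ⪯ h'^*(s), since for monotone g the
-- map R ↾ (g ∘ h) is bounded by g ∘ h'. Consequently, for H ∈ QBS the map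
-- 𝒬(R) ↾ (H ∘ h^*) is bounded by H ∘ h'^*, so a 𝒬(𝒬(R)) b gives
-- (h^*)^*(a) ⊴ (h'^*)^*(b). Decomposability turns this into
-- μ((h^*)^*(a)) ⪯ μ((h'^*)^*(b)), i.e. h^*(μ a) ⪯ h'^*(μ b), and leaf
-- monotonicity makes ⪯ imply the required inequality of modalities.
module Submission where

open import Defs
open import Data.List using (List; []; _∷_)
open import Data.Product using (_,_; proj₁)
open import Function using (_∘_; id)
open import Relation.Binary.PropositionalEquality using (_≡_; refl; sym)
open import Relation.Binary.Structures using (IsPartialOrder; IsPreorder)
open import Relation.Binary.Bundles using (Poset)
import Relation.Binary.Reasoning.PartialOrder as ≤-Reasoning

latticePoset : CompleteLattice → Poset _ _ _
latticePoset L = record { isPartialOrder = CompleteLattice.isPartialOrder L }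

module _ (S : Signature) where

  mapLabel-∘ : {A B C : Set} (g : B → C) (f : A → B) (l : Label S A) →
               mapLabel S g (mapLabel S f l) ≡ mapLabel S (g ∘ f) l
  mapLabel-∘ g f botL        = refl
  mapLabel-∘ g f (leafL x)   = refl
  mapLabel-∘ g f (nodeL σ m) = refl

  mapLabel-id : {A : Set} (l : Label S A) → mapLabel S id l ≡ l
  mapLabel-id botL        = refl
  mapLabel-id (leafL x)   = refl
  mapLabel-id (nodeL σ m) = refl

  tmap-μ : {A B : Set} (h : A → B) (a : Tree S (Tree S A)) (p : List _) →
           tmap S h (μ S a) p ≡ μ S (tmap S (tmap S h) a) p
  tmap-μ h a p with a []
  tmap-μ h a p       | botL      = refl
  tmap-μ h a p       | leafL s   = refl
  tmap-μ h a []      | nodeL σ m = refl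
  tmap-μ h a (i ∷ p) | nodeL σ m = tmap-μ h (sub S a i) p

  module _ (L : CompleteLattice) where
    open CompleteLattice L renaming (Carrier to Q)
    open IsPartialOrder isPartialOrder using (isPreorder)
    open IsPreorder isPreorder using (reflexive)

    LabelRel-mapLabel : {A : Set} {f g : A → Q} → (∀ x → f x ≤ g x) →
                        (l : Label S A) →
                        LabelRel S _≤_ (mapLabel S f l) (mapLabel S g l)
    LabelRel-mapLabel f≤g botL        = botR
    LabelRel-mapLabel f≤g (leafL x)   = leafR (f≤g x)
    LabelRel-mapLabel f≤g (nodeL σ m) = nodeR σ m

    LabelRel-reflexive : {l l' : Label S Q} → l ≡ l' → LabelRel S _≤_ l l'
    LabelRel-reflexive {botL}      refl = botR
    LabelRel-reflexive {leafL x}   refl = leafR (reflexive refl)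
    LabelRel-reflexive {nodeL σ m} refl = nodeR σ m

    ↾-∘-monotone : {X Y : Set} (R : X → Y → Set) (h : X → Q) {g : Q → Q} →
                   ({a b : Q} → a ≤ b → g a ≤ g b) →
                   (y : Y) → _↾_ S L R (g ∘ h) y ≤ g (_↾_ S L R h y)
    ↾-∘-monotone R h g-mono y =
      ⋁-least _ _ λ xr → g-mono (⋁-upper (h ∘ proj₁) xr)

    module _ {q : Modality S L} (q-mono : LeafMonotone S L q) where

      LeafMonotone-pointwise : {t r : Tree S Q} →
                               (∀ p → LabelRel S _≤_ (t p) (r p)) → q t ≤ q r
      LeafMonotone-pointwise t≤r = q-mono _ _ λ p _ → t≤r p

      LeafMonotone-≗ : {t r : Tree S Q} → (∀ p → t p ≡ r p) → q t ≤ q r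
      LeafMonotone-≗ t≗r = LeafMonotone-pointwise λ p → LabelRel-reflexive (t≗r p)

      ∈ₘ-tmap-≤ : {A B : Set} (t : Tree S A) (f : A → B) (g : B → Q) →
                  _∈ₘ_⟨_⟩ S L (tmap S f t) q g ≤ _∈ₘ_⟨_⟩ S L t q (g ∘ f)
      ∈ₘ-tmap-≤ t f g = LeafMonotone-≗ λ p → mapLabel-∘ g f (t p)

      ∈ₘ-tmap-≥ : {A B : Set} (t : Tree S A) (f : A → B) (g : B → Q) →
                  _∈ₘ_⟨_⟩ S L t q (g ∘ f) ≤ _∈ₘ_⟨_⟩ S L (tmap S f t) q g
      ∈ₘ-tmap-≥ t f g = LeafMonotone-≗ λ p → sym (mapLabel-∘ g f (t p))

      ∈ₘ-mono : {A : Set} (t : Tree S A) {k k' : A → Q} → (∀ x → k x ≤ k' x) →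
                _∈ₘ_⟨_⟩ S L t q k ≤ _∈ₘ_⟨_⟩ S L t q k'
      ∈ₘ-mono t k≤k' = LeafMonotone-pointwise λ p → LabelRel-mapLabel k≤k' (t p)

    module _ (𝒬 : Modality S L → Set)
             (leafMonotone : (q : Modality S L) → 𝒬 q → LeafMonotone S L q) where

      open ≤-Reasoning (latticePoset L)

      Rel𝒬-tmap : {X Y A : Set} {R : X → Y → Set} {t : Tree S X} {s : Tree S Y} →
                  Rel𝒬 S L 𝒬 R t s → {q : Modality S L} → 𝒬 q →
                  (f : X → A) (f' : Y → A) (g : A → Q) →
                  (∀ y → _↾_ S L R (g ∘ f) y ≤ g (f' y)) →
                  _∈ₘ_⟨_⟩ S L (tmap S f t) q g ≤ _∈ₘ_⟨_⟩ S L (tmap S f' s) q g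
      Rel𝒬-tmap {R = R} {t} {s} t~s {q} q∈𝒬 f f' g bound = begin
        _∈ₘ_⟨_⟩ S L (tmap S f t) q g         ≤⟨ ∈ₘ-tmap-≤ q-mono t f g ⟩
        _∈ₘ_⟨_⟩ S L t q (g ∘ f)              ≤⟨ t~s q q∈𝒬 (g ∘ f) ⟩
        _∈ₘ_⟨_⟩ S L s q (_↾_ S L R (g ∘ f))  ≤⟨ ∈ₘ-mono q-mono s bound ⟩
        _∈ₘ_⟨_⟩ S L s q (g ∘ f')             ≤⟨ ∈ₘ-tmap-≥ q-mono s f' g ⟩
        _∈ₘ_⟨_⟩ S L (tmap S f' s) q g        ∎
        where
        q-mono : LeafMonotone S L q
        q-mono = leafMonotone q q∈𝒬

      Rel𝒬⇒⪯ : {X Y : Set} {R : X → Y → Set} {t : Tree S X} {s : Tree S Y} →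
               Rel𝒬 S L 𝒬 R t s → (h : X → Q) →
               _⪯_ S L 𝒬 (tmap S h t) (tmap S (_↾_ S L R h) s)
      Rel𝒬⇒⪯ {R = R} t~s h q q∈𝒬 g g-mono =
        Rel𝒬-tmap t~s q∈𝒬 h (_↾_ S L R h) g (↾-∘-monotone R h g-mono)

      ⪯⇒≤ : {t t' : Tree S Q} → _⪯_ S L 𝒬 t t' → {q : Modality S L} → 𝒬 q → q t ≤ q t'
      ⪯⇒≤ {t} {t'} t⪯t' {q} q∈𝒬 = begin
        q t              ≤⟨ LeafMonotone-≗ q-mono (λ p → sym (mapLabel-id (t p))) ⟩
        q (tmap S id t)  ≤⟨ t⪯t' q q∈𝒬 id id ⟩
        q (tmap S id t') ≤⟨ LeafMonotone-≗ q-mono (λ p → mapLabel-id (t' p)) ⟩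
        q t'             ∎
        where
        q-mono : LeafMonotone S L q
        q-mono = leafMonotone q q∈𝒬

      ↾-QBS : {X Y : Set} (R : X → Y → Set) (h : X → Q) {H : Tree S Q → Q} →
              QBS S L 𝒬 H → (s : Tree S Y) →
              _↾_ S L (Rel𝒬 S L 𝒬 R) (H ∘ tmap S h) s ≤ H (tmap S (_↾_ S L R h) s)
      ↾-QBS R h H-qbs s = ⋁-least _ _ λ (t , t~s) → H-qbs _ _ (Rel𝒬⇒⪯ t~s h)

      Rel𝒬²⇒⊴ : {X Y : Set} {R : X → Y → Set}
                {a : Tree S (Tree S X)} {b : Tree S (Tree S Y)} →
                Rel𝒬 S L 𝒬 (Rel𝒬 S L 𝒬 R) a b → (h : X → Q) →
                _⊴_ S L 𝒬 (tmap S (tmap S h) a) (tmap S (tmap S (_↾_ S L R h)) b)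
      Rel𝒬²⇒⊴ {R = R} a~b h q q∈𝒬 H H-qbs =
        Rel𝒬-tmap a~b q∈𝒬 (tmap S h) (tmap S (_↾_ S L R h)) H (↾-QBS R h H-qbs)

lemma23 : (S : Signature) (L : CompleteLattice)
          (𝒬 : Modality S L → Set) →
          Decomposable S L 𝒬 →
          ((q : Modality S L) → 𝒬 q → LeafMonotone S L q) →
          {X Y : Set} (R : X → Y → Set)
          (a : Tree S (Tree S X)) (b : Tree S (Tree S Y)) →
          Rel𝒬 S L 𝒬 (Rel𝒬 S L 𝒬 R) a b →
          Rel𝒬 S L 𝒬 R (μ S a) (μ S b)
lemma23 S L 𝒬 decomposable leafMonotone {Y = Y} R a b a~b q q∈𝒬 h = begin
  q (tmap S h (μ S a))            ≤⟨ LeafMonotone-≗ S L q-mono (tmap-μ S h a) ⟩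
  q (μ S (tmap S (tmap S h) a))   ≤⟨ ⪯⇒≤ S L 𝒬 leafMonotone μr⪯μr' q∈𝒬 ⟩
  q (μ S (tmap S (tmap S h') b))  ≤⟨ LeafMonotone-≗ S L q-mono (sym ∘ tmap-μ S h' b) ⟩
  q (tmap S h' (μ S b))           ∎
  where
  open ≤-Reasoning (latticePoset L)
  open CompleteLattice L using () renaming (Carrier to Q)

  q-mono : LeafMonotone S L q
  q-mono = leafMonotone q q∈𝒬

  h' : Y → Q
  h' = _↾_ S L R h

  μr⪯μr' : _⪯_ S L 𝒬 (μ S (tmap S (tmap S h) a)) (μ S (tmap S (tmap S h') b))
  μr⪯μr' = decomposable _ _ (Rel𝒬²⇒⊴ S L 𝒬 leafMonotone a~b h)
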